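{- The rules A1–A8 are sound: for every instance of each rule, every team satisfying the premise (if any) satisfies the conclusion. Consequently, if $\Sigma\vdash x|_p y$ then $\Sigma\models x|_p y$.
   Context: Fix a set $\mathcal{V}$ of variables and a set $M$ of values; an assignment is a function $s:\mathcal{V}\to M$ and a team is a finite set of assignments. Finite tuples of variables (repetitions allowed) are written $x,y,u,v,\dots$; $|x|$ is the length, $s(x)$ the tuple of values, and juxtaposition denotes concatenation. An exclusion atom $x|y$ ($|x|=|y|$) is satisfied by $T$ iff $s_1(x)\neq s_2(y)$ for all $s_1,s_2\in T$. For a real $0\le p\le 1$, an approximate exclusion atom is $x|_p y$ with $|x|=|y|$, and $T\models x|_p y$ iff there is $T'\subseteq T$ with $|T'|\le p\cdot|T|$ such that $T\setminus T'\models x|y$. $\Sigma\models\varphi$ means every team satisfying all atoms of $\Sigma$ satisfies $\varphi$. Rules (schemata over tuples making atoms well formed): (A1) $x|_p x\vdash y|_0 z$ for $p<1$; (A2) $x|_p y\vdash y|_p x$; (A3) $x|_p y\vdash xu|_p yv$; (A4) $xuu|_p yvv\vdash xu|_p yv$; (A5) $xyz|_p uvw\vdash xzy|_p uwv$ where $|x|=|u|$, $|y|=|v|$; (A6) $xw|_p yw\vdash zz|_p xy$; (A7) $x|_q y\vdash x|_p y$ for $q\le p\le 1$; (A8) $\vdash x|_1 y$. $\Sigma\vdash\varphi$ means $\varphi$ is derivable from atoms of $\Sigma$ by finitely many applications of these rules. -}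

module Defs where

open import Data.Nat as ℕ using (ℕ; zero; suc)
open import Data.Integer using (+_)
open import Data.Rational as ℚ using (ℚ; 0ℚ; 1ℚ; _<_)
open import Data.Rational.Properties as ℚP using (≤-refl; ≤-trans; <-irrefl; <-≤-trans; ≰⇒>; <-dense)
open import Data.Fin using (Fin)
open import Data.Fin.Subset using (Subset; _∈_; _∉_; ∣_∣)
open import Data.Vec using (Vec; map; _++_)
open import Data.List using (List; []; _∷_)
open import Data.List.Relation.Unary.All using (All)
open import Data.Product using (Σ; ∃; _×_; _,_)
open import Relation.Binary.PropositionalEquality using (_≡_; _≢_; refl)
open import Relation.Nullary using (¬_)
open import Function.Definitions using (Injective)

-- Real numbers p with 0 ≤ p ≤ 1, represented (Dedekind style) by their
-- closed lower rational cut  L p = { q ∈ ℚ | q ≤ p }.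
-- Classically these records correspond exactly to reals in [0,1]:
-- L is down-closed, contains 0, is bounded by 1, and is closed
-- (if q ∉ L there is a smaller r ∉ L), so L = (-∞ , sup L] ∩ ℚ.

record Prob : Set₁ where
  field
    le        : ℚ → Set
    downward  : ∀ {q r} → q ℚ.≤ r → le r → le q
    has-zero  : le 0ℚ
    bounded   : ∀ {q} → le q → q ℚ.≤ 1ℚ
    closed    : ∀ {q} → ¬ le q → Σ ℚ λ r → r < q × ¬ le r
open Prob public

const : (c : ℚ) → 0ℚ ℚ.≤ c → c ℚ.≤ 1ℚ → Prob
const c 0≤c c≤1 = record
  { le       = λ q → q ℚ.≤ c
  ; downward = ≤-trans
  ; has-zero = 0≤c
  ; bounded  = λ q≤c → ≤-trans q≤c c≤1
  ; closed   = λ {q} q≰c → let (r , c<r , r<q) = <-dense (≰⇒> q≰c)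
                           in r , r<q , (λ r≤c → <-irrefl refl (<-≤-trans c<r r≤c))
  }

zeroP : Prob
zeroP = const 0ℚ ≤-refl (ℚ.*≤* (Data.Integer.+≤+ ℕ.z≤n))
  where import Data.Integer

oneP : Prob
oneP = const 1ℚ (ℚ.*≤* (Data.Integer.+≤+ ℕ.z≤n)) ≤-refl
  where import Data.Integer

_≤P_ : Prob → Prob → Set
q ≤P p = ∀ r → le q r → le p r

_<1 : Prob → Set
p <1 = ¬ le p 1ℚ

_≤[_]·_ : ℕ → Prob → ℕ → Set
k ≤[ p ]· zero  = k ≡ 0
k ≤[ p ]· suc n = le p ((+ k) ℚ./ suc n)

module Teams (𝒱 M : Set) where

  Assignment : Set
  Assignment = 𝒱 → M

  -- a team: a finite SET of assignments, enumerated without repetition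
  record Team : Set where
    field
      size  : ℕ
      asg   : Fin size → Assignment
      inj   : Injective _≡_ _≡_ asg
  open Team public

  val : ∀ {k} → Assignment → Vec 𝒱 k → Vec M k
  val s x = map s x

  record Atom : Set₁ where
    constructor _∣[_]_
    field
      {len} : ℕ
      lhs   : Vec 𝒱 len
      prob  : Prob
      rhs   : Vec 𝒱 len

  _⊨_ : Team → Atom → Set
  T ⊨ (x ∣[ p ] y) =
    Σ (Subset (size T)) λ T' →
      ∣ T' ∣ ≤[ p ]· size T ×
      (∀ i j → i ∉ T' → j ∉ T' → val (asg T i) x ≢ val (asg T j) y)

  _⊨ₛ_ : (Atom → Set) → Atom → Set₁
  Σ₀ ⊨ₛ φ = ∀ (T : Team) → (∀ ψ → Σ₀ ψ → T ⊨ ψ) → T ⊨ φ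

  data Rule : List Atom → Atom → Set₁ where
    A1 : ∀ {k m p} (x : Vec 𝒱 k) (y z : Vec 𝒱 m) → p <1 →
         Rule ((x ∣[ p ] x) ∷ []) (y ∣[ zeroP ] z)
    A2 : ∀ {k p} (x y : Vec 𝒱 k) →
         Rule ((x ∣[ p ] y) ∷ []) (y ∣[ p ] x)
    A3 : ∀ {k m p} (x y : Vec 𝒱 k) (u v : Vec 𝒱 m) →
         Rule ((x ∣[ p ] y) ∷ []) ((x ++ u) ∣[ p ] (y ++ v))
    A4 : ∀ {k m p} (x y : Vec 𝒱 k) (u v : Vec 𝒱 m) →
         Rule (((x ++ u ++ u) ∣[ p ] (y ++ v ++ v)) ∷ []) ((x ++ u) ∣[ p ] (y ++ v))
    A5 : ∀ {k l m p} (x u : Vec 𝒱 k) (y v : Vec 𝒱 l) (z w : Vec 𝒱 m) →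
         Rule (((x ++ y ++ z) ∣[ p ] (u ++ v ++ w)) ∷ [])
              ((x ++ z ++ y) ∣[ p ] (u ++ w ++ v))
    A6 : ∀ {k m p} (x y z : Vec 𝒱 k) (w : Vec 𝒱 m) →
         Rule (((x ++ w) ∣[ p ] (y ++ w)) ∷ []) ((z ++ z) ∣[ p ] (x ++ y))
    A7 : ∀ {k p q} (x y : Vec 𝒱 k) → q ≤P p →
         Rule ((x ∣[ q ] y) ∷ []) (x ∣[ p ] y)
    A8 : ∀ {k} (x y : Vec 𝒱 k) →
         Rule [] (x ∣[ oneP ] y)

  data _⊢_ (Σ₀ : Atom → Set) : Atom → Set₁ where
    assumption : ∀ {φ} → Σ₀ φ → Σ₀ ⊢ φ
    by-rule    : ∀ {prems φ} → Rule prems φ → All (Σ₀ ⊢_) prems → Σ₀ ⊢ φ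

module Submission where

-- Each rule only shrinks the set of value clashes (A2–A6) or relaxes the
-- budget of discarded assignments (A7, A8), so a witness T' for the premise
-- is a witness for the conclusion.  A1 is the exception: in x |_p x every
-- assignment clashes with itself, so all of T must be discarded, which the
-- budget p·|T| < |T| allows only for the empty team.

open import Defs
open import Data.Empty using (⊥-elim)
open import Data.Fin using (Fin)
open import Data.Fin.Subset using (Subset; _∈_; ∣_∣; ⊤; ⊥)
open import Data.Fin.Subset.Properties using (_∈?_; ∈⊤; ⊆⊤; ⊆-antisym; ∣⊤∣≡n; ∣⊥∣≡0)
open import Data.Integer using (+_)
open import Data.Integer.Properties using (*-comm)
open import Data.List using (List; []; _∷_)
open import Data.List.Relation.Unary.All using (All; []; _∷_)
open import Data.Nat using (zero; suc)
open import Data.Product using (_×_; _,_; proj₁)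
import Data.Rational as ℚ
open import Data.Rational using (1ℚ)
open import Data.Rational.Properties using (fromℚᵘ-cong; 0/n≡0; ≤-reflexive)
open import Data.Rational.Unnormalised using (mkℚᵘ; *≡*)
open import Data.Vec using (Vec; _++_; map)
open import Data.Vec.Properties using (map-++; ++-injective)
open import Relation.Binary.PropositionalEquality
open import Relation.Nullary using (¬_; yes; no)

n/n≡1 : ∀ n → (+ suc n) ℚ./ suc n ≡ 1ℚ
n/n≡1 n = fromℚᵘ-cong {mkℚᵘ (+ suc n) n} {mkℚᵘ (+ 1) 0} (*≡* (*-comm (+ suc n) (+ 1)))

0≤[_]·_ : ∀ p n → 0 ≤[ p ]· n
0≤[ p ]· zero  = refl
0≤[ p ]· suc n = subst (le p) (sym (0/n≡0 (suc n))) (has-zero p)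

n≤[1]·n : ∀ n → n ≤[ oneP ]· n
n≤[1]·n zero    = refl
n≤[1]·n (suc n) = ≤-reflexive (n/n≡1 n)

≤[]·-mono : ∀ {p q} → q ≤P p → ∀ {k} n → k ≤[ q ]· n → k ≤[ p ]· n
≤[]·-mono q≤p zero    k≡0 = k≡0
≤[]·-mono q≤p (suc n) k≤q = q≤p _ k≤q

n≤[<1]·n⇒empty : ∀ {p} → p <1 → ∀ n → n ≤[ p ]· n → ¬ Fin n
n≤[<1]·n⇒empty {p} p<1 (suc n) n≤p _ = p<1 (subst (le p) (n/n≡1 n) n≤p)

∀∈⇒∣∣≡n : ∀ {n} (S : Subset n) → (∀ i → i ∈ S) → ∣ S ∣ ≡ n
∀∈⇒∣∣≡n {n} S ∀∈ = trans (cong ∣_∣ (⊆-antisym ⊆⊤ (λ {i} _ → ∀∈ i))) (∣⊤∣≡n n)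

module Soundness (𝒱 M : Set) where
  open Teams 𝒱 M

  val-++⁻ : ∀ {k m} (s t : Assignment) (x y : Vec 𝒱 k) (u v : Vec 𝒱 m) →
            val s (x ++ u) ≡ val t (y ++ v) → val s x ≡ val t y × val s u ≡ val t v
  val-++⁻ s t x y u v e =
    ++-injective (map s x) (map t y) (trans (sym (map-++ s x u)) (trans e (map-++ t y v)))

  val-++⁺ : ∀ {k m} (s t : Assignment) (x y : Vec 𝒱 k) (u v : Vec 𝒱 m) →
            val s x ≡ val t y → val s u ≡ val t v → val s (x ++ u) ≡ val t (y ++ v)
  val-++⁺ s t x y u v ex eu =
    trans (map-++ s x u) (trans (cong₂ _++_ ex eu) (sym (map-++ t y v)))

  ⊨-transport : ∀ {k l p} (T : Team) (x y : Vec 𝒱 k) (x' y' : Vec 𝒱 l) →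
                (∀ s t → val s x' ≡ val t y' → val s x ≡ val t y) →
                T ⊨ (x ∣[ p ] y) → T ⊨ (x' ∣[ p ] y')
  ⊨-transport T x y x' y' f (T' , ∣T'∣≤ , excl) =
    T' , ∣T'∣≤ , λ i j i∉ j∉ e → excl i j i∉ j∉ (f (asg T i) (asg T j) e)

  ⊨-self-exclusion⇒empty : ∀ {k p} (T : Team) (x : Vec 𝒱 k) → p <1 →
                           T ⊨ (x ∣[ p ] x) → ¬ Fin (size T)
  ⊨-self-exclusion⇒empty T x p<1 (T' , ∣T'∣≤ , excl) =
    n≤[<1]·n⇒empty p<1 (size T) (subst (_≤[ _ ]· size T) (∀∈⇒∣∣≡n T' discarded) ∣T'∣≤)
    where
    discarded : ∀ i → i ∈ T'
    discarded i with i ∈? T'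
    ... | yes i∈ = i∈
    ... | no  i∉ = ⊥-elim (excl i i i∉ i∉ refl)

  rule-sound : ∀ (prems : List Atom) (φ : Atom) → Rule prems φ →
               ∀ (T : Team) → All (T ⊨_) prems → T ⊨ φ
  rule-sound _ _ (A1 x y z p<1) T (h ∷ []) =
    ⊥ , subst (_≤[ zeroP ]· size T) (sym (∣⊥∣≡0 (size T))) (0≤[ zeroP ]· size T) ,
    λ i _ _ _ _ → ⊥-elim (⊨-self-exclusion⇒empty T x p<1 h i)
  rule-sound _ _ (A2 x y) T ((T' , ∣T'∣≤ , excl) ∷ []) =
    T' , ∣T'∣≤ , λ i j i∉ j∉ e → excl j i j∉ i∉ (sym e)
  rule-sound _ _ (A3 x y u v) T (h ∷ []) =
    ⊨-transport T x y (x ++ u) (y ++ v) (λ s t e → proj₁ (val-++⁻ s t x y u v e)) h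
  rule-sound _ _ (A4 x y u v) T (h ∷ []) =
    ⊨-transport T (x ++ u ++ u) (y ++ v ++ v) (x ++ u) (y ++ v) duplicate h
    where
    duplicate : ∀ s t → val s (x ++ u) ≡ val t (y ++ v) →
                val s (x ++ u ++ u) ≡ val t (y ++ v ++ v)
    duplicate s t e = let ex , eu = val-++⁻ s t x y u v e in
      val-++⁺ s t x y (u ++ u) (v ++ v) ex (val-++⁺ s t u v u v eu eu)
  rule-sound _ _ (A5 x u y v z w) T (h ∷ []) =
    ⊨-transport T (x ++ y ++ z) (u ++ v ++ w) (x ++ z ++ y) (u ++ w ++ v) swap h
    where
    swap : ∀ s t → val s (x ++ z ++ y) ≡ val t (u ++ w ++ v) →
           val s (x ++ y ++ z) ≡ val t (u ++ v ++ w)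
    swap s t e = let ex , ezy = val-++⁻ s t x u (z ++ y) (w ++ v) e
                     ez , ey  = val-++⁻ s t z w y v ezy in
      val-++⁺ s t x u (y ++ z) (v ++ w) ex (val-++⁺ s t y v z w ey ez)
  -- A clash s(zz) = t(xy) forces t(x) = t(y), so t clashes with itself in the premise.
  rule-sound _ _ (A6 x y z w) T ((T' , ∣T'∣≤ , excl) ∷ []) =
    T' , ∣T'∣≤ , λ i j i∉ j∉ e →
      let ezx , ezy = val-++⁻ (asg T i) (asg T j) z x z y e
          t = asg T j in
      excl j j j∉ j∉ (val-++⁺ t t x y w w (trans (sym ezx) ezy) refl)
  rule-sound _ _ (A7 x y q≤p) T ((T' , ∣T'∣≤ , excl) ∷ []) =
    T' , ≤[]·-mono q≤p (size T) ∣T'∣≤ , excl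
  rule-sound _ _ (A8 x y) T [] =
    ⊤ , subst (_≤[ oneP ]· size T) (sym (∣⊤∣≡n (size T))) (n≤[1]·n (size T)) ,
    λ i _ i∉ _ _ → i∉ ∈⊤

  mutual
    ⊢-sound : ∀ (Σ₀ : Atom → Set) (φ : Atom) → Σ₀ ⊢ φ → Σ₀ ⊨ₛ φ
    ⊢-sound Σ₀ φ (assumption φ∈Σ₀) T T⊨Σ₀ = T⊨Σ₀ φ φ∈Σ₀
    ⊢-sound Σ₀ φ (by-rule r ds)    T T⊨Σ₀ = rule-sound _ φ r T (⊢-soundAll Σ₀ ds T T⊨Σ₀)

    ⊢-soundAll : ∀ (Σ₀ : Atom → Set) {φs} → All (Σ₀ ⊢_) φs →
                 ∀ T → (∀ ψ → Σ₀ ψ → T ⊨ ψ) → All (T ⊨_) φs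
    ⊢-soundAll Σ₀ []       T T⊨Σ₀ = []
    ⊢-soundAll Σ₀ (d ∷ ds) T T⊨Σ₀ = ⊢-sound Σ₀ _ d T T⊨Σ₀ ∷ ⊢-soundAll Σ₀ ds T T⊨Σ₀

lemma3 : (𝒱 M : Set) → let open Teams 𝒱 M in
    (∀ (prems : List Atom) (φ : Atom) → Rule prems φ →
       ∀ (T : Team) → All (T ⊨_) prems → T ⊨ φ)
    × (∀ (Σ₀ : Atom → Set) (φ : Atom) → Σ₀ ⊢ φ → Σ₀ ⊨ₛ φ)
lemma3 𝒱 M = rule-sound , ⊢-sound
  where open Soundness 𝒱 M
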